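{- Let $V=V_1\sqcup V_2\sqcup V_3$ be a tripartition of a vertex set and let $F$ be a tripartite pair matching. Then the $3$-graph on $V$ obtained by adding the $3$-edges of $F$ to $T_{V_1,V_2,V_3}$ is $F_{3,2}$-free.
   Context: A $3$-graph is a pair $(V,E)$ with $E$ a set of $3$-subsets of $V$. $T_{V_1,V_2,V_3}$ is the $3$-graph on $V$ whose $3$-edges are all triples with two vertices in $V_i$ and one in $V_{i+1}$ for some $i\in\{1,2,3\}$ (indices mod $3$). A tripartite $3$-edge is a triple $x_1x_2x_3$ with $x_i\in V_i$. A set $F$ of tripartite $3$-edges is a tripartite pair matching if any two distinct members of $F$ share at most one vertex. $F_{3,2}$ is the $3$-graph on $\{1,\dots,5\}$ with $3$-edges $123,124,125,345$; $F_{3,2}$-free means no subgraph isomorphic to $F_{3,2}$. -}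

module Defs where

open import Data.Fin using (Fin; zero; suc)
open import Data.Product using (_×_; ∃; Σ; _,_)
open import Data.Sum using (_⊎_)
open import Relation.Binary.PropositionalEquality using (_≡_; _≢_)
open import Relation.Nullary using (¬_)
open import Function.Definitions using (Injective)

-- A tripartition V = V₁ ⊔ V₂ ⊔ V₃ of a vertex type V is a map  part : V → Fin 3
-- (part v = 0,1,2 means v ∈ V₁,V₂,V₃ respectively).

next : Fin 3 → Fin 3
next zero = suc zero
next (suc zero) = suc (suc zero)
next (suc (suc zero)) = zero

-- A "ternary relation" on V; a 3-graph is represented by the predicate
-- "the 3-set {x,y,z} is an edge", which is symmetric by construction below.
Rel3 : Set → Set₁
Rel3 V = V → V → V → Set

Sym3 : {V : Set} → Rel3 V → Rel3 V
Sym3 P x y z = P x y z ⊎ P x z y ⊎ P y x z ⊎ P y z x ⊎ P z x y ⊎ P z y x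

Distinct3 : {V : Set} → Rel3 V
Distinct3 x y z = x ≢ y × x ≢ z × y ≢ z

TOrd : {V : Set} → (V → Fin 3) → Rel3 V
TOrd part a b c = part a ≡ part b × part c ≡ next (part a)

TEdge : {V : Set} → (V → Fin 3) → Rel3 V
TEdge part x y z = Distinct3 x y z × Sym3 (TOrd part) x y z

-- A set F of tripartite 3-edges is given as a predicate on ordered triples
-- (x₁,x₂,x₃) with xᵢ ∈ Vᵢ.
Tripartite : {V : Set} → (V → Fin 3) → Rel3 V → Set
Tripartite part F = ∀ a b c → F a b c →
  part a ≡ zero × part b ≡ suc zero × part c ≡ suc (suc zero)

_∈₃_ : {V : Set} → V → V × V × V → Set
u ∈₃ (a , b , c) = u ≡ a ⊎ u ≡ b ⊎ u ≡ c

ShareTwo : {V : Set} → V × V × V → V × V × V → Set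
ShareTwo {V} e f = Σ V λ u → Σ V λ v →
  u ≢ v × u ∈₃ e × v ∈₃ e × u ∈₃ f × v ∈₃ f

PairMatching : {V : Set} → (V → Fin 3) → Rel3 V → Set
PairMatching {V} part F = Tripartite part F ×
  (∀ a b c a' b' c' → F a b c → F a' b' c' →
     (a , b , c) ≢ (a' , b' , c') → ¬ ShareTwo (a , b , c) (a' , b' , c'))

TplusF : {V : Set} → (V → Fin 3) → Rel3 V → Rel3 V
TplusF part F x y z = TEdge part x y z ⊎ Sym3 F x y z

-- F_{3,2}: vertices 1..5 (here Fin 5 indices 0..4), edges 123,124,125,345.
-- H contains a copy of F_{3,2} iff there is an injective φ : Fin 5 → V with
-- φ(123), φ(124), φ(125), φ(345) edges of H.
ContainsF32 : {V : Set} → Rel3 V → Set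
ContainsF32 {V} H = Σ (Fin 5 → V) λ φ → Injective _≡_ _≡_ φ ×
  H (φ v1) (φ v2) (φ v3) × H (φ v1) (φ v2) (φ v4) ×
  H (φ v1) (φ v2) (φ v5) × H (φ v3) (φ v4) (φ v5)
  where
  v1 v2 v3 v4 v5 : Fin 5
  v1 = zero
  v2 = suc zero
  v3 = suc (suc zero)
  v4 = suc (suc (suc zero))
  v5 = suc (suc (suc (suc zero)))

F32-free : {V : Set} → Rel3 V → Set
F32-free H = ¬ ContainsF32 H

module Submission where

-- Colour every vertex by its part, so every 3-set gets a colour
-- profile in Fin 3.  An edge of T_{V₁,V₂,V₃} has a "T-profile" {i,i,i+1} and
-- an edge of F, being tripartite, has a "rainbow" profile {0,1,2}.  Suppose
-- φ embeds F_{3,2} with edges abc, abd, abe, cde.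
--   * Since F is a pair matching, the pair ab lies in at most one F-edge, so
--     at least two of abc, abd, abe are T-edges.
--   * Key lemma on profiles: if x and y are both T-completions of the colour
--     pair (p,q) and z is any completion of (p,q) to an edge profile, then
--     {x,y,z} is not an edge profile.  Indeed x = y (the T-completion of a
--     pair is unique); if z is a T-completion too, {x,x,x} is monochromatic;
--     otherwise {x,x,z} would force z = x+1, while the rainbow completion of
--     (p,q) is x+2.
-- The file first develops these facts about colour profiles (each decided by
-- evaluation over the finite set Fin 3), then the facts about pair matchings,
-- and finally derives the theorem by a case split on abc, abd, abe.

open import Defs
open import Data.Fin using (Fin; zero; suc)
open import Data.Fin.Properties using (_≟_; all?)
open import Data.Product using (Σ; _×_; _,_; proj₁; proj₂)
open import Data.Sum using (_⊎_; inj₁; inj₂; map; map₁)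
open import Data.Empty using (⊥)
open import Function using (id; _∘_)
open import Relation.Binary.PropositionalEquality
  using (_≡_; _≢_; refl; sym; cong; subst; module ≡-Reasoning)
open import Relation.Nullary using (¬_; Dec)
open import Relation.Nullary.Decidable
  using (toWitness; ¬?; _×-dec_; _⊎-dec_; _→-dec_)

Sym3-map : {A B : Set} {P : Rel3 A} {Q : Rel3 B} (f : A → B) →
  (∀ {x y z} → P x y z → Q (f x) (f y) (f z)) →
  ∀ {x y z} → Sym3 P x y z → Sym3 Q (f x) (f y) (f z)
Sym3-map f h = map h (map h (map h (map h (map h h))))

Sym3-dec : {A : Set} {P : Rel3 A} → (∀ x y z → Dec (P x y z)) →
  ∀ x y z → Dec (Sym3 P x y z)
Sym3-dec P? x y z =
  P? x y z ⊎-dec P? x z y ⊎-dec P? y x z ⊎-dec P? y z x ⊎-dec P? z x y ⊎-dec P? z y x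

Tri : Rel3 (Fin 3)
Tri = Sym3 (TOrd id)

Rainbow : Rel3 (Fin 3)
Rainbow = Distinct3

Profile : Rel3 (Fin 3)
Profile p q r = Tri p q r ⊎ Rainbow p q r

tri? : ∀ p q r → Dec (Tri p q r)
tri? = Sym3-dec λ p q r → (p ≟ q) ×-dec (r ≟ next p)

rainbow? : ∀ p q r → Dec (Rainbow p q r)
rainbow? p q r = ¬? (p ≟ q) ×-dec ¬? (p ≟ r) ×-dec ¬? (q ≟ r)

profile? : ∀ p q r → Dec (Profile p q r)
profile? p q r = tri? p q r ⊎-dec rainbow? p q r

next-no-fixpoint : ∀ u → u ≢ next u
next-no-fixpoint zero ()
next-no-fixpoint (suc zero) ()
next-no-fixpoint (suc (suc zero)) ()

T-completion-unique : ∀ {p q x y} → Tri p q x → Tri p q y → x ≡ y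
T-completion-unique {p} {q} {x} {y} = toWitness {a? = check} _ p q x y
  where
  check : Dec (∀ p q x y → Tri p q x → Tri p q y → x ≡ y)
  check = all? λ p → all? λ q → all? λ x → all? λ y →
            tri? p q x →-dec tri? p q y →-dec x ≟ y

rainbow-completion-unique : ∀ {p q x y} → Rainbow p q x → Rainbow p q y → x ≡ y
rainbow-completion-unique {p} {q} {x} {y} = toWitness {a? = check} _ p q x y
  where
  check : Dec (∀ p q x y → Rainbow p q x → Rainbow p q y → x ≡ y)
  check = all? λ p → all? λ q → all? λ x → all? λ y →
            rainbow? p q x →-dec rainbow? p q y →-dec x ≟ y

repeated-colour : ∀ {u s} → Profile u u s → s ≡ next u
repeated-colour {u} {s} = toWitness {a? = check} _ u s
  where
  check : Dec (∀ u s → Profile u u s → s ≡ next u)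
  check = all? λ u → all? λ s → profile? u u s →-dec s ≟ next u

rainbow-not-successor : ∀ {p q x z} → Tri p q x → Rainbow p q z → z ≢ next x
rainbow-not-successor {p} {q} {x} {z} = toWitness {a? = check} _ p q x z
  where
  check : Dec (∀ p q x z → Tri p q x → Rainbow p q z → z ≢ next x)
  check = all? λ p → all? λ q → all? λ x → all? λ z →
            tri? p q x →-dec rainbow? p q z →-dec ¬? (z ≟ next x)

profile-symmetric : ∀ {p q r} → Sym3 Profile p q r → Profile p q r
profile-symmetric {p} {q} {r} = toWitness {a? = check} _ p q r
  where
  check : Dec (∀ p q r → Sym3 Profile p q r → Profile p q r)
  check = all? λ p → all? λ q → all? λ r →
            Sym3-dec profile? p q r →-dec profile? p q r

profile-swap₂₃ : ∀ {p q r} → Profile p r q → Profile p q r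
profile-swap₂₃ = profile-symmetric ∘ inj₂ ∘ inj₁

profile-rotate : ∀ {p q r} → Profile r p q → Profile p q r
profile-rotate = profile-symmetric ∘ inj₂ ∘ inj₂ ∘ inj₂ ∘ inj₂ ∘ inj₁

rainbow-symmetric : ∀ {p q r} → Sym3 Rainbow p q r → Rainbow p q r
rainbow-symmetric {p} {q} {r} = toWitness {a? = check} _ p q r
  where
  check : Dec (∀ p q r → Sym3 Rainbow p q r → Rainbow p q r)
  check = all? λ p → all? λ q → all? λ r →
            Sym3-dec rainbow? p q r →-dec rainbow? p q r

apex-lemma : ∀ {p q x y z} → Tri p q x → Tri p q y → Profile p q z →
  ¬ Profile x y z
apex-lemma tx ty pz with T-completion-unique tx ty
apex-lemma tx ty (inj₁ tz) | refl with T-completion-unique tx tz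
... | refl = next-no-fixpoint _ ∘ repeated-colour
apex-lemma tx ty (inj₂ rz) | refl = rainbow-not-successor tx rz ∘ repeated-colour

listing : {V : Set} {P : Rel3 V} {a b c : V} → Sym3 P a b c →
  Σ V λ x₁ → Σ V λ x₂ → Σ V λ x₃ → P x₁ x₂ x₃ ×
    a ∈₃ (x₁ , x₂ , x₃) × b ∈₃ (x₁ , x₂ , x₃) × c ∈₃ (x₁ , x₂ , x₃)
listing {a = a} {b} {c} (inj₁ f) =
  a , b , c , f , inj₁ refl , inj₂ (inj₁ refl) , inj₂ (inj₂ refl)
listing {a = a} {b} {c} (inj₂ (inj₁ f)) =
  a , c , b , f , inj₁ refl , inj₂ (inj₂ refl) , inj₂ (inj₁ refl)
listing {a = a} {b} {c} (inj₂ (inj₂ (inj₁ f))) =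
  b , a , c , f , inj₂ (inj₁ refl) , inj₁ refl , inj₂ (inj₂ refl)
listing {a = a} {b} {c} (inj₂ (inj₂ (inj₂ (inj₁ f)))) =
  b , c , a , f , inj₂ (inj₂ refl) , inj₁ refl , inj₂ (inj₁ refl)
listing {a = a} {b} {c} (inj₂ (inj₂ (inj₂ (inj₂ (inj₁ f))))) =
  c , a , b , f , inj₂ (inj₁ refl) , inj₂ (inj₂ refl) , inj₁ refl
listing {a = a} {b} {c} (inj₂ (inj₂ (inj₂ (inj₂ (inj₂ f))))) =
  c , b , a , f , inj₂ (inj₂ refl) , inj₂ (inj₁ refl) , inj₁ refl

component : {V : Set} → V × V × V → Fin 3 → V
component (x , _ , _) zero = x
component (_ , x , _) (suc zero) = x
component (_ , _ , x) (suc (suc zero)) = x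

module _ {V : Set} (part : V → Fin 3) {F : Rel3 V} (tri : Tripartite part F) where

  member-by-part : ∀ {x₁ x₂ x₃ u} → F x₁ x₂ x₃ → u ∈₃ (x₁ , x₂ , x₃) →
    u ≡ component (x₁ , x₂ , x₃) (part u)
  member-by-part f (inj₁ refl) rewrite proj₁ (tri _ _ _ f) = refl
  member-by-part f (inj₂ (inj₁ refl)) rewrite proj₁ (proj₂ (tri _ _ _ f)) = refl
  member-by-part f (inj₂ (inj₂ refl)) rewrite proj₂ (proj₂ (tri _ _ _ f)) = refl

  F-profile : ∀ {x y z} → Sym3 F x y z → Rainbow (part x) (part y) (part z)
  F-profile s = rainbow-symmetric (Sym3-map {Q = Rainbow} part tripartite-rainbow s)
    where
    tripartite-rainbow : ∀ {a b c} → F a b c → Rainbow (part a) (part b) (part c)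
    tripartite-rainbow f with tri _ _ _ f
    ... | pa , pb , pc rewrite pa | pb | pc = (λ ()) , (λ ()) , (λ ())

  edge-profile : ∀ {x y z} → TplusF part F x y z → Profile (part x) (part y) (part z)
  edge-profile = map proj₂ F-profile

  edge-kind : ∀ {x y z} → TplusF part F x y z →
    Tri (part x) (part y) (part z) ⊎ Sym3 F x y z
  edge-kind = map₁ proj₂

  pair-in-one-F-edge : (∀ a b c a′ b′ c′ → F a b c → F a′ b′ c′ →
      (a , b , c) ≢ (a′ , b′ , c′) → ¬ ShareTwo (a , b , c) (a′ , b′ , c′)) →
    ∀ {a b c d} → a ≢ b → c ≢ d → Sym3 F a b c → Sym3 F a b d → ⊥
  pair-in-one-F-edge matching {a} {b} {c} {d} a≢b c≢d fc fd
    with listing fc | listing fd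
  ... | x₁ , x₂ , x₃ , f , a∈ , b∈ , c∈ | y₁ , y₂ , y₃ , g , a∈′ , b∈′ , d∈ =
    matching x₁ x₂ x₃ y₁ y₂ y₃ f g different (a , b , a≢b , a∈ , b∈ , a∈′ , b∈′)
    where
    open ≡-Reasoning
    t : V × V × V
    t = (x₁ , x₂ , x₃)
    same-colour : part c ≡ part d
    same-colour = rainbow-completion-unique (F-profile fc) (F-profile fd)
    different : t ≢ (y₁ , y₂ , y₃)
    different t≡ = c≢d (begin
      c                      ≡⟨ member-by-part f c∈ ⟩
      component t (part c)   ≡⟨ cong (component t) same-colour ⟩
      component t (part d)   ≡⟨ sym (member-by-part f (subst (d ∈₃_) (sym t≡) d∈)) ⟩
      d                      ∎)

-- Main theorem: T_{V₁,V₂,V₃} + F is F_{3,2}-free.  Two of abc, abd, abe are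
-- T-edges (else ab lies in two F-edges), and then cde contradicts apex-lemma.
proposition4p11 : (V : Set) (part : V → Fin 3) (F : Rel3 V) →
    PairMatching part F → F32-free (TplusF part F)
proposition4p11 V part F (tri , matching) (φ , inj , abc , abd , abe , cde) =
  cases (edge-kind part tri abc) (edge-kind part tri abd) (edge-kind part tri abe)
  where
  apart : ∀ {i j} → i ≢ j → φ i ≢ φ j
  apart i≢j = i≢j ∘ inj
  a b c d e : V
  a = φ zero
  b = φ (suc zero)
  c = φ (suc (suc zero))
  d = φ (suc (suc (suc zero)))
  e = φ (suc (suc (suc (suc zero))))
  profile : ∀ {x y z} → TplusF part F x y z → Profile (part x) (part y) (part z)
  profile = edge-profile part tri
  no-shared-pair : ∀ {x y} → x ≢ y → Sym3 F a b x → Sym3 F a b y → ⊥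
  no-shared-pair = pair-in-one-F-edge part tri matching (apart λ ())
  cases : Tri (part a) (part b) (part c) ⊎ Sym3 F a b c →
    Tri (part a) (part b) (part d) ⊎ Sym3 F a b d →
    Tri (part a) (part b) (part e) ⊎ Sym3 F a b e → ⊥
  cases (inj₁ tc) (inj₁ td) _ = apex-lemma tc td (profile abe) (profile cde)
  cases (inj₁ tc) _ (inj₁ te) =
    apex-lemma tc te (profile abd) (profile-swap₂₃ (profile cde))
  cases _ (inj₁ td) (inj₁ te) =
    apex-lemma td te (profile abc) (profile-rotate (profile cde))
  cases (inj₂ fc) (inj₂ fd) _ = no-shared-pair (apart λ ()) fc fd
  cases (inj₂ fc) _ (inj₂ fe) = no-shared-pair (apart λ ()) fc fe
  cases _ (inj₂ fd) (inj₂ fe) = no-shared-pair (apart λ ()) fd fe
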